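{- Let $n\ge1$ and let $\beta(n)$ be the largest integer such that $2^{\beta(n)}$ divides $n!$. For every summation tree $T$ with $n$ leaves, the number of computationally inequivalent summations on $n$ distinct summands whose underlying tree is isomorphic to $T$ is at least $\frac{n!}{2^{\beta(n)}}$.
   Context: A summation tree is a rooted full binary tree (every node has $0$ or $2$ children). Two summation trees are isomorphic if one can be obtained from the other by a finite sequence of swaps of the two children (with their subtrees) of internal nodes. A summation on $n$ distinct summands is a summation tree with $n$ leaves with a bijective labelling of its leaves by the summands; two summations are computationally equivalent if one can be obtained from the other by a finite sequence of such child swaps (carrying labels along). -}

module Defs where

open import Data.Nat using (ℕ; suc; _+_)
open import Data.Fin using (Fin)
open import Data.List using (List; []; _∷_; _++_; allFin)
open import Data.Product using (Σ; proj₁)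
open import Data.List.Relation.Binary.Permutation.Propositional using (_↭_)
open import Relation.Binary.Construct.Closure.ReflexiveTransitive using (Star)

data Tree : Set where
  leaf : Tree
  node : Tree → Tree → Tree

leaves : Tree → ℕ
leaves leaf       = 1
leaves (node l r) = leaves l + leaves r

data Swap : Tree → Tree → Set where
  here  : ∀ {l r} → Swap (node l r) (node r l)
  left  : ∀ {l l′ r} → Swap l l′ → Swap (node l r) (node l′ r)
  right : ∀ {l r r′} → Swap r r′ → Swap (node l r) (node l r′)

_≅_ : Tree → Tree → Set
_≅_ = Star Swap

data LTree (A : Set) : Set where
  lleaf : A → LTree A
  lnode : LTree A → LTree A → LTree A

shape : ∀ {A} → LTree A → Tree
shape (lleaf _)   = leaf
shape (lnode l r) = node (shape l) (shape r)

labels : ∀ {A} → LTree A → List A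
labels (lleaf a)   = a ∷ []
labels (lnode l r) = labels l ++ labels r

-- A summation on n distinct summands (the summands are Fin n):
-- a labelled tree whose leaf labelling is a bijection onto Fin n,
-- i.e. every summand labels exactly one leaf.
Summation : ℕ → Set
Summation n = Σ (LTree (Fin n)) λ t → labels t ↭ allFin n

data LSwap {A : Set} : LTree A → LTree A → Set where
  here  : ∀ {l r} → LSwap (lnode l r) (lnode r l)
  left  : ∀ {l l′ r} → LSwap l l′ → LSwap (lnode l r) (lnode l′ r)
  right : ∀ {l r r′} → LSwap r r′ → LSwap (lnode l r) (lnode l r′)

_≈c_ : ∀ {n} → Summation n → Summation n → Set
s ≈c t = Star LSwap (proj₁ s) (proj₁ t)

module Submission where

-- Labellings of T are generated recursively: at a node whose children have a and c leaves, the
-- summands are split into a left part of size a and a right part of size c (all such splits when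
-- a ≠ c, only those putting the first summand on the left when a = c), and both children are
-- labelled recursively. Child swaps preserve the label set below each child, and at every node a
-- left label set can never be matched with a right one (they differ in size or in containing the
-- first summand), so no two generated labellings are computationally equivalent. Exactly n!/2^k
-- labellings arise, k being the number of nodes with equal-size children; as 2^k ∣ n! while
-- 2^(β+1) ∤ n!, k ≤ β, so there are at least n!/2^β.

open import Defs
open import Data.Nat using (ℕ; suc; _≤_; _^_)
open import Data.Nat.Properties using (m^n≢0)
open import Data.Nat.DivMod using (_/_)
open import Data.Nat.Divisibility using (_∣_)
open import Data.Nat using (_!)
open import Data.List using (List; length)
open import Data.List.Relation.Unary.All using (All)
open import Data.List.Relation.Unary.AllPairs using (AllPairs)
open import Data.Product using (Σ; _×_; proj₁)
open import Relation.Binary.PropositionalEquality using (_≡_)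
open import Relation.Nullary using (¬_)

open import Data.Bool using (if_then_else_)
open import Data.Empty using (⊥)
open import Data.Nat using (zero; _+_; _*_; _∸_; _<_; z≤n; s≤s; _≟_; NonZero)
open import Data.Nat.Properties
  using (+-identityʳ; *-comm; *-distribʳ-+; +-cancelˡ-≡; suc-injective; m≤m+n; m≤n+m; m+n∸m≡n; m+n∸n≡m;
         ≤-trans; ≤-reflexive; ≮⇒≥; ^-distribˡ-+-*; ^-monoʳ-≤; [m*n]*[o*p]≡[m*o]*[n*p]; _!*_!≢0)
open import Data.Nat.Combinatorics
  using (_C_; nCk≡n!/k![n-k]!; k![n∸k]!∣n!; nCk+nC[k+1]≡[n+1]C[k+1]; nCk≡nC[n∸k])
open import Data.Nat.DivMod using (m/n*n≡m; m*n/n≡m; /-monoʳ-≤)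
open import Data.Nat.Divisibility using (divides; ∣-trans; 1∣_; *-monoʳ-∣)
open import Data.Fin using (Fin)
open import Data.List using ([]; _∷_; _++_; map; concatMap; allFin)
open import Data.List.Properties using (length-++; length-map; length-tabulate)
open import Data.List.Relation.Unary.All as All using ([]; _∷_)
import Data.List.Relation.Unary.All.Properties as Allₚ
open import Data.List.Relation.Unary.AllPairs as AllPairs using ([]; _∷_)
import Data.List.Relation.Unary.AllPairs.Properties as AllPairsₚ
open import Data.List.Relation.Unary.Any using (here)
open import Data.List.Relation.Unary.Unique.Propositional using (Unique)
open import Data.List.Relation.Unary.Unique.Propositional.Properties using (Unique[x∷xs]⇒x∉xs; allFin⁺)
open import Data.List.Relation.Binary.Permutation.Propositional
  using (_↭_; prep; ↭-refl; ↭-sym; ↭-trans; ↭⇒↭ₛ)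
open import Data.List.Relation.Binary.Permutation.Propositional.Properties
  using (∈-resp-↭; ↭-length; shift; drop-∷; ++-comm)
  renaming (++⁺ to ↭-++⁺)
import Data.List.Relation.Binary.Permutation.Setoid.Properties as Permutationₛ
open import Data.List.Membership.Propositional using (_∈_; _∉_)
open import Data.List.Membership.Propositional.Properties using (∈-++⁺ˡ; ∈-++⁺ʳ)
open import Data.Product using (_,_; proj₂; map₁; map₂)
open import Data.Nat.Tactic.RingSolver using (solve-∀)
open import Function using (_∘_)
open import Relation.Binary.Definitions using (Transitive; _Respects_)
open import Relation.Binary.PropositionalEquality
  using (refl; sym; trans; cong; cong₂; subst; setoid; module ≡-Reasoning)
open import Relation.Binary.Construct.Closure.ReflexiveTransitive using (Star; ε; _◅_)
open import Relation.Nullary using (Dec; yes; no; does)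

open ≡-Reasoning

module _ {A B : Set} where

  All-concatMap⁺ : ∀ {P : A → Set} {Q : B → Set} {f : A → List B} {xs} →
                   (∀ {x} → P x → All Q (f x)) → All P xs → All Q (concatMap f xs)
  All-concatMap⁺ g = Allₚ.concat⁺ ∘ Allₚ.map⁺ ∘ All.map g

  AllPairs-concatMap⁺ : ∀ {Q : A → Set} {S : A → A → Set} {R : B → B → Set} {f : A → List B} {xs} →
                        (∀ {x} → Q x → AllPairs R (f x)) →
                        (∀ {x y} → Q x → Q y → S x y → All (λ u → All (R u) (f y)) (f x)) →
                        All Q xs → AllPairs S xs → AllPairs R (concatMap f xs)
  AllPairs-concatMap⁺ within between [] [] = []
  AllPairs-concatMap⁺ within between (q ∷ qs) (s ∷ ss) =
    AllPairsₚ.++⁺ (within q) (AllPairs-concatMap⁺ within between qs ss)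
      (All.map (Allₚ.concat⁺ ∘ Allₚ.map⁺)
        (Allₚ.All-swap (All.zipWith (λ (q′ , s′) → between q q′ s′) (qs , s))))

  length-concatMap : ∀ {m c} {f : A → List B} {xs} →
                     All (λ x → length (f x) * m ≡ c) xs → length (concatMap f xs) * m ≡ length xs * c
  length-concatMap [] = refl
  length-concatMap {m} {c} {f} {x ∷ xs} (e ∷ es) = begin
    length (f x ++ concatMap f xs) * m               ≡⟨ cong (_* m) (length-++ (f x)) ⟩
    (length (f x) + length (concatMap f xs)) * m     ≡⟨ *-distribʳ-+ m (length (f x)) _ ⟩
    length (f x) * m + length (concatMap f xs) * m   ≡⟨ cong₂ _+_ e (length-concatMap es) ⟩
    c + length xs * c                                ∎

module _ {A : Set} where

  AllPairs-++⁻ : ∀ {R : A → A → Set} xs {ys} → AllPairs R (xs ++ ys) → AllPairs R xs × AllPairs R ys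
  AllPairs-++⁻ []       rs       = [] , rs
  AllPairs-++⁻ (x ∷ xs) (r ∷ rs) =
    (Allₚ.++⁻ˡ xs r ∷ proj₁ (AllPairs-++⁻ xs rs)) , proj₂ (AllPairs-++⁻ xs rs)

  Unique-++⁻-↭ : ∀ {xs ys zs : List A} → ys ++ zs ↭ xs → Unique xs → Unique ys × Unique zs
  Unique-++⁻-↭ {ys = ys} p u =
    AllPairs-++⁻ ys (Permutationₛ.Unique-resp-↭ (setoid A) (↭⇒↭ₛ (↭-sym p)) u)

-- Labelled trees up to child swaps

module _ {A : Set} where

  infix 4 _≋_ _≉_

  data _≋_ : LTree A → LTree A → Set where
    lleaf    : ∀ {a} → lleaf a ≋ lleaf a
    straight : ∀ {l r l′ r′} → l ≋ l′ → r ≋ r′ → lnode l r ≋ lnode l′ r′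
    crossed  : ∀ {l r l′ r′} → l ≋ r′ → r ≋ l′ → lnode l r ≋ lnode l′ r′

  _≉_ : LTree A → LTree A → Set
  s ≉ t = ¬ s ≋ t

  ≋-refl : ∀ t → t ≋ t
  ≋-refl (lleaf a)   = lleaf
  ≋-refl (lnode l r) = straight (≋-refl l) (≋-refl r)

  ≋-trans : Transitive _≋_
  ≋-trans lleaf          lleaf            = lleaf
  ≋-trans (straight p q) (straight p′ q′) = straight (≋-trans p p′) (≋-trans q q′)
  ≋-trans (straight p q) (crossed p′ q′)  = crossed (≋-trans p p′) (≋-trans q q′)
  ≋-trans (crossed p q)  (straight p′ q′) = crossed (≋-trans p q′) (≋-trans q p′)
  ≋-trans (crossed p q)  (crossed p′ q′)  = straight (≋-trans p q′) (≋-trans q p′)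

  LSwap⇒≋ : ∀ {s t} → LSwap s t → s ≋ t
  LSwap⇒≋ (here {l} {r})    = crossed (≋-refl l) (≋-refl r)
  LSwap⇒≋ (left {r = r} p)  = straight (LSwap⇒≋ p) (≋-refl r)
  LSwap⇒≋ (right {l = l} p) = straight (≋-refl l) (LSwap⇒≋ p)

  Star-LSwap⇒≋ : ∀ {s t} → Star LSwap s t → s ≋ t
  Star-LSwap⇒≋ {s} ε   = ≋-refl s
  Star-LSwap⇒≋ (p ◅ ps) = ≋-trans (LSwap⇒≋ p) (Star-LSwap⇒≋ ps)

  ≋⇒labels-↭ : ∀ {s t} → s ≋ t → labels s ↭ labels t
  ≋⇒labels-↭ lleaf          = ↭-refl
  ≋⇒labels-↭ (straight p q) = ↭-++⁺ (≋⇒labels-↭ p) (≋⇒labels-↭ q)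
  ≋⇒labels-↭ (crossed {l′ = l′} {r′} p q) =
    ↭-trans (↭-++⁺ (≋⇒labels-↭ p) (≋⇒labels-↭ q)) (++-comm (labels r′) (labels l′))

  ≉-of-labels : ∀ {s t ys ys′} → labels s ↭ ys → labels t ↭ ys′ → ¬ (ys ↭ ys′) → s ≉ t
  ≉-of-labels q q′ ys≁ys′ s≋t = ys≁ys′ (↭-trans (↭-sym q) (↭-trans (≋⇒labels-↭ s≋t) q′))

  lnode-≉ʳ : ∀ {l r r′} → r ≉ r′ → lnode l r ≉ lnode l r′
  lnode-≉ʳ r≉r′ (straight _ r≋r′)   = r≉r′ r≋r′
  lnode-≉ʳ r≉r′ (crossed l≋r′ r≋l) = r≉r′ (≋-trans r≋l l≋r′)

  graft : List (LTree A) → List (LTree A) → List (LTree A)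
  graft ls rs = concatMap (λ l → map (lnode l) rs) ls

  length-graft : ∀ ls rs → length (graft ls rs) ≡ length ls * length rs
  length-graft []       rs = refl
  length-graft (l ∷ ls) rs = begin
    length (map (lnode l) rs ++ graft ls rs)          ≡⟨ length-++ (map (lnode l) rs) ⟩
    length (map (lnode l) rs) + length (graft ls rs)  ≡⟨ cong₂ _+_ (length-map (lnode l) rs) (length-graft ls rs) ⟩
    length rs + length ls * length rs                 ∎

  All-graft⁺ : ∀ {P Q S : LTree A → Set} {ls rs} → (∀ {l r} → P l → Q r → S (lnode l r)) →
               All P ls → All Q rs → All S (graft ls rs)
  All-graft⁺ f ps qs = All-concatMap⁺ (λ p → Allₚ.map⁺ (All.map (f p) qs)) ps

  -- IsLeft singles out the label sets of left children, so a crossed match of two grafted trees is impossible.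
  module _ (IsLeft : List A → Set) (IsLeft-resp : IsLeft Respects _↭_) where

    lnode-≉ˡ : ∀ {l r l′ r′} → IsLeft (labels l) → ¬ IsLeft (labels r′) →
               l ≉ l′ → lnode l r ≉ lnode l′ r′
    lnode-≉ˡ _      _       l≉l′ (straight l≋l′ _) = l≉l′ l≋l′
    lnode-≉ˡ isLeft notLeft _ (crossed l≋r′ _)    = notLeft (IsLeft-resp (≋⇒labels-↭ l≋r′) isLeft)

    graft-inequivalent : ∀ {ls rs} → All (IsLeft ∘ labels) ls → All (¬_ ∘ IsLeft ∘ labels) rs →
                         AllPairs _≉_ ls → AllPairs _≉_ rs → AllPairs _≉_ (graft ls rs)
    graft-inequivalent {rs = rs} lefts rights ls≉ rs≉ =
      AllPairs-concatMap⁺ (λ _ → AllPairsₚ.map⁺ (AllPairs.map lnode-≉ʳ rs≉))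
        (λ isLeft _ l≉l′ → Allₚ.map⁺ (All.universal
           (λ _ → Allₚ.map⁺ (All.map (λ notLeft → lnode-≉ˡ isLeft notLeft l≉l′) rights)) rs))
        lefts ls≉

    graft-apart : ∀ {ls rs ls′ rs′} → All (IsLeft ∘ labels) ls → All (¬_ ∘ IsLeft ∘ labels) rs′ →
                  All (λ l → All (l ≉_) ls′) ls → All (λ t → All (t ≉_) (graft ls′ rs′)) (graft ls rs)
    graft-apart {rs = rs} lefts rights′ apart =
      All-concatMap⁺
        (λ (isLeft , l≉ls′) → Allₚ.map⁺ (All.universal
           (λ _ → All-graft⁺ (λ l≉l′ notLeft → lnode-≉ˡ isLeft notLeft l≉l′) l≉ls′ rights′) rs))
        (All.zip (lefts , apart))

-- Splitting the summands between the two children of the root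

module _ {A : Set} where

  IsSplitOf : ℕ → List A → List A × List A → Set
  IsSplitOf k xs (ys , zs) = length ys ≡ k × ys ++ zs ↭ xs

  DifferOnLeft : List A × List A → List A × List A → Set
  DifferOnLeft (ys , _) (ys′ , _) = ¬ (ys ↭ ys′)

  splits : ℕ → List A → List (List A × List A)
  splits zero    xs       = ([] , xs) ∷ []
  splits (suc k) []       = []
  splits (suc k) (x ∷ xs) = map (map₁ (x ∷_)) (splits k xs) ++ map (map₂ (x ∷_)) (splits (suc k) xs)

  headSplits : ℕ → List A → List (List A × List A)
  headSplits k       []       = []
  headSplits zero    (x ∷ xs) = []
  headSplits (suc k) (x ∷ xs) = map (map₁ (x ∷_)) (splits k xs)

  rootSplits : ∀ {a c : ℕ} → Dec (a ≡ c) → List A → List (List A × List A)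
  rootSplits {a} (yes _) = headSplits a
  rootSplits {a} (no _)  = splits a

  splits-isSplit : ∀ k xs → All (IsSplitOf k xs) (splits k xs)
  splits-isSplit zero    xs       = (refl , ↭-refl) ∷ []
  splits-isSplit (suc k) []       = []
  splits-isSplit (suc k) (x ∷ xs) = Allₚ.++⁺
    (Allₚ.map⁺ (All.map (λ (e , q) → cong suc e , prep x q) (splits-isSplit k xs)))
    (Allₚ.map⁺ (All.map (λ {(ys , zs)} (e , q) → e , ↭-trans (shift x ys zs) (prep x q))
                        (splits-isSplit (suc k) xs)))

  headSplits-isSplit : ∀ k xs → All (IsSplitOf k xs) (headSplits k xs)
  headSplits-isSplit k       []       = []
  headSplits-isSplit zero    (x ∷ xs) = []
  headSplits-isSplit (suc k) (x ∷ xs) =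
    Allₚ.map⁺ (All.map (λ (e , q) → cong suc e , prep x q) (splits-isSplit k xs))

  rootSplits-isSplit : ∀ {a c} (d : Dec (a ≡ c)) xs → All (IsSplitOf a xs) (rootSplits d xs)
  rootSplits-isSplit {a} (yes _) = headSplits-isSplit a
  rootSplits-isSplit {a} (no _)  = splits-isSplit a

  isSplit-length-right : ∀ {a c xs} p → length xs ≡ a + c → IsSplitOf a xs p → length (proj₂ p) ≡ c
  isSplit-length-right {a} {c} {xs} (ys , zs) len (refl , q) = +-cancelˡ-≡ a _ _ (begin
    length ys + length zs  ≡⟨ length-++ ys ⟨
    length (ys ++ zs)      ≡⟨ ↭-length q ⟩
    length xs              ≡⟨ len ⟩
    length ys + c          ∎)

  splits-distinct : ∀ k {xs} → Unique xs → AllPairs DifferOnLeft (splits k xs)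
  splits-distinct zero    _                 = [] ∷ []
  splits-distinct (suc k) {[]}     _        = []
  splits-distinct (suc k) {x ∷ xs} u@(_ ∷ u′) = AllPairsₚ.++⁺
    (AllPairsₚ.map⁺ (AllPairs.map (_∘ drop-∷) (splits-distinct k u′)))
    (AllPairsₚ.map⁺ (splits-distinct (suc k) u′))
    (Allₚ.map⁺ (All.universal (λ _ → Allₚ.map⁺ (All.map left-lacks-x (splits-isSplit (suc k) xs))) _))
    where
    left-lacks-x : ∀ {ys zs ws} → IsSplitOf (suc k) xs (ys , zs) → ¬ (x ∷ ws ↭ ys)
    left-lacks-x (_ , q) perm = Unique[x∷xs]⇒x∉xs u (∈-resp-↭ q (∈-++⁺ˡ (∈-resp-↭ perm (here refl))))

  headSplits-distinct : ∀ k {xs} → Unique xs → AllPairs DifferOnLeft (headSplits k xs)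
  headSplits-distinct k       {[]}     _        = []
  headSplits-distinct zero    {x ∷ xs} _        = []
  headSplits-distinct (suc k) {x ∷ xs} (_ ∷ u′) =
    AllPairsₚ.map⁺ (AllPairs.map (_∘ drop-∷) (splits-distinct k u′))

  rootSplits-distinct : ∀ {a c xs} (d : Dec (a ≡ c)) → Unique xs → AllPairs DifferOnLeft (rootSplits d xs)
  rootSplits-distinct {a} (yes _) = headSplits-distinct a
  rootSplits-distinct {a} (no _)  = splits-distinct a

  headSplits-head : ∀ k {x xs} → x ∉ xs →
                    All (λ p → x ∈ proj₁ p × x ∉ proj₂ p) (headSplits k (x ∷ xs))
  headSplits-head zero    _    = []
  headSplits-head (suc k) {xs = xs} x∉xs =
    Allₚ.map⁺ (All.map (λ {(ys , zs)} (_ , q) → here refl , x∉xs ∘ ∈-resp-↭ q ∘ ∈-++⁺ʳ ys)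
                       (splits-isSplit k xs))

  -- Children of different sizes are told apart by size, children of equal size by the
  -- first summand, which headSplits always sends left.
  rootSplits-separated : ∀ {a c xs} → Unique xs → length xs ≡ a + c → (d : Dec (a ≡ c)) →
    Σ (List A → Set) λ IsLeft → IsLeft Respects _↭_ ×
      All (λ p → IsLeft (proj₁ p) × ¬ IsLeft (proj₂ p)) (rootSplits d xs)
  rootSplits-separated {a} {c} {xs} _ len (no a≢c) =
    (λ ys → length ys ≡ a) , (λ q → trans (sym (↭-length q))) ,
    All.map (λ {p} s → proj₁ s , λ e → a≢c (trans (sym e) (isSplit-length-right p len s)))
            (splits-isSplit a xs)
  rootSplits-separated {xs = []}         _ _ (yes _) = (λ _ → ⊥) , (λ _ ()) , []
  rootSplits-separated {a} {xs = x ∷ xs} u _ (yes _) =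
    (x ∈_) , ∈-resp-↭ , headSplits-head a (Unique[x∷xs]⇒x∉xs u)

-- Counting splits

length-splits : ∀ {A : Set} k (xs : List A) → length (splits k xs) ≡ length xs C k
length-splits zero    xs       = refl
length-splits (suc k) []       = refl
length-splits (suc k) (x ∷ xs) = begin
  length (map (map₁ (x ∷_)) (splits k xs) ++ map (map₂ (x ∷_)) (splits (suc k) xs))
    ≡⟨ length-++ (map (map₁ (x ∷_)) (splits k xs)) ⟩
  length (map (map₁ (x ∷_)) (splits k xs)) + length (map (map₂ (x ∷_)) (splits (suc k) xs))
    ≡⟨ cong₂ _+_ (length-map (map₁ (x ∷_)) (splits k xs)) (length-map (map₂ (x ∷_)) (splits (suc k) xs)) ⟩
  length (splits k xs) + length (splits (suc k) xs)
    ≡⟨ cong₂ _+_ (length-splits k xs) (length-splits (suc k) xs) ⟩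
  length xs C k + length xs C suc k
    ≡⟨ nCk+nC[k+1]≡[n+1]C[k+1] (length xs) k ⟩
  suc (length xs) C suc k
    ∎

central-binomial : ∀ k → ((k + suc k) C k) * 2 ≡ (suc k + suc k) C suc k
central-binomial k = begin
  (n C k) * 2                ≡⟨ *-comm (n C k) 2 ⟩
  n C k + (n C k + 0)        ≡⟨ cong (n C k +_) (+-identityʳ (n C k)) ⟩
  n C k + n C k              ≡⟨ cong (λ j → n C k + n C j) (m+n∸n≡m k (suc k)) ⟨
  n C k + n C (n ∸ suc k)    ≡⟨ cong (n C k +_) (nCk≡nC[n∸k] (m≤n+m (suc k) k)) ⟨
  n C k + n C suc k          ≡⟨ nCk+nC[k+1]≡[n+1]C[k+1] n k ⟩
  suc n C suc k              ∎
  where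
  n : ℕ
  n = k + suc k

length-headSplits : ∀ {A : Set} {a c} {xs : List A} → 0 < a → a ≡ c → length xs ≡ a + c →
                    length (headSplits a xs) * 2 ≡ (a + c) C a
length-headSplits {a = suc k} {xs = []}     _ refl ()
length-headSplits {a = suc k} {xs = x ∷ xs} _ refl len = begin
  length (map (map₁ (x ∷_)) (splits k xs)) * 2  ≡⟨ cong (_* 2) (length-map (map₁ (x ∷_)) (splits k xs)) ⟩
  length (splits k xs) * 2                      ≡⟨ cong (_* 2) (length-splits k xs) ⟩
  (length xs C k) * 2                           ≡⟨ cong (λ m → (m C k) * 2) (suc-injective len) ⟩
  ((k + suc k) C k) * 2                         ≡⟨ central-binomial k ⟩
  (suc k + suc k) C suc k                       ∎

nCk*[k!*[n∸k]!]≡n! : ∀ {n k} → k ≤ n → (n C k) * (k ! * (n ∸ k) !) ≡ n !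
nCk*[k!*[n∸k]!]≡n! {n} {k} k≤n = begin
  (n C k) * (k ! * (n ∸ k) !)                    ≡⟨ cong (_* (k ! * (n ∸ k) !)) (nCk≡n!/k![n-k]! k≤n) ⟩
  (n ! / (k ! * (n ∸ k) !)) * (k ! * (n ∸ k) !)  ≡⟨ m/n*n≡m (k![n∸k]!∣n! k≤n) ⟩
  n !                                            ∎
  where instance _ = k !* (n ∸ k) !≢0

[a+c]Ca*[a!*c!]≡[a+c]! : ∀ a c → ((a + c) C a) * (a ! * c !) ≡ (a + c) !
[a+c]Ca*[a!*c!]≡[a+c]! a c =
  subst (λ b → ((a + c) C a) * (a ! * b !) ≡ (a + c) !) (m+n∸m≡n a c) (nCk*[k!*[n∸k]!]≡n! (m≤m+n a c))

-- Pairwise inequivalent labellings of a tree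

0<leaves : ∀ T → 0 < leaves T
0<leaves leaf       = s≤s z≤n
0<leaves (node L R) = ≤-trans (0<leaves L) (m≤m+n (leaves L) (leaves R))

-- Each internal node whose children have equally many leaves halves the number of labellings produced.
symmetricNodes : Tree → ℕ
symmetricNodes leaf       = 0
symmetricNodes (node L R) = if does (leaves L ≟ leaves R) then suc s else s
  where
  s : ℕ
  s = symmetricNodes L + symmetricNodes R

module _ {A : Set} where

  labellings : Tree → List A → List (LTree A)
  labellings leaf       (x ∷ []) = lleaf x ∷ []
  labellings leaf       _        = []
  labellings (node L R) xs       =
    concatMap (λ p → graft (labellings L (proj₁ p)) (labellings R (proj₂ p)))
              (rootSplits (leaves L ≟ leaves R) xs)

  labellings-sound : ∀ T xs → All (λ t → shape t ≡ T × labels t ↭ xs) (labellings T xs)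
  labellings-sound leaf       []          = []
  labellings-sound leaf       (x ∷ [])    = (refl , ↭-refl) ∷ []
  labellings-sound leaf       (_ ∷ _ ∷ _) = []
  labellings-sound (node L R) xs          = All-concatMap⁺
    (λ (_ , ys++zs↭xs) →
       All-graft⁺ (λ (eL , qL) (eR , qR) → cong₂ node eL eR , ↭-trans (↭-++⁺ qL qR) ys++zs↭xs)
                  (labellings-sound L _) (labellings-sound R _))
    (rootSplits-isSplit (leaves L ≟ leaves R) xs)

  labellings-labels : ∀ T xs → All (λ t → labels t ↭ xs) (labellings T xs)
  labellings-labels T xs = All.map proj₂ (labellings-sound T xs)

  labellings-inequivalent : ∀ T {xs} → Unique xs → length xs ≡ leaves T → AllPairs _≉_ (labellings T xs)
  labellings-inequivalent leaf       {[]}        _ _   = []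
  labellings-inequivalent leaf       {x ∷ []}    _ _   = [] ∷ []
  labellings-inequivalent leaf       {_ ∷ _ ∷ _} _ _   = []
  labellings-inequivalent (node L R) {xs}        u len = separated (rootSplits-separated u len d)
    where
    a : ℕ
    a = leaves L
    d : Dec (leaves L ≡ leaves R)
    d = leaves L ≟ leaves R

    separated : (Σ (List A → Set) λ IsLeft → IsLeft Respects _↭_ ×
                  All (λ p → IsLeft (proj₁ p) × ¬ IsLeft (proj₂ p)) (rootSplits d xs)) →
                AllPairs _≉_ (labellings (node L R) xs)
    separated (IsLeft , resp , sides) =
      AllPairs-concatMap⁺ within between (All.zip (rootSplits-isSplit d xs , sides)) (rootSplits-distinct d u)
      where
      Oriented : List A × List A → Set
      Oriented p = IsSplitOf a xs p × IsLeft (proj₁ p) × ¬ IsLeft (proj₂ p)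

      lefts : ∀ {ys} → IsLeft ys → All (IsLeft ∘ labels) (labellings L ys)
      lefts isLeft = All.map (λ q → resp (↭-sym q) isLeft) (labellings-labels L _)

      rights : ∀ {zs} → ¬ IsLeft zs → All (¬_ ∘ IsLeft ∘ labels) (labellings R zs)
      rights notLeft = All.map (λ q → notLeft ∘ resp q) (labellings-labels R _)

      within : ∀ {p} → Oriented p → AllPairs _≉_ (graft (labellings L (proj₁ p)) (labellings R (proj₂ p)))
      within {ys , zs} (split , isLeft , notLeft) =
        graft-inequivalent IsLeft resp (lefts isLeft) (rights notLeft)
          (labellings-inequivalent L (proj₁ unique) (proj₁ split))
          (labellings-inequivalent R (proj₂ unique) (isSplit-length-right (ys , zs) len split))
        where unique = Unique-++⁻-↭ (proj₂ split) u

      between : ∀ {p q} → Oriented p → Oriented q → DifferOnLeft p q →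
                All (λ t → All (t ≉_) (graft (labellings L (proj₁ q)) (labellings R (proj₂ q))))
                    (graft (labellings L (proj₁ p)) (labellings R (proj₂ p)))
      between (_ , isLeft , _) (_ , _ , notLeft′) ys≁ys′ =
        graft-apart IsLeft resp (lefts isLeft) (rights notLeft′)
          (All.map (λ q → All.map (λ q′ → ≉-of-labels q q′ ys≁ys′) (labellings-labels L _))
                   (labellings-labels L _))

  labellings-count : ∀ T {xs} → length xs ≡ leaves T →
                     length (labellings T xs) * 2 ^ symmetricNodes T ≡ leaves T !
  labellings-count leaf       {[]}        ()
  labellings-count leaf       {x ∷ []}    _   = refl
  labellings-count leaf       {_ ∷ _ ∷ _} ()
  labellings-count (node L R) {xs}        len = count (leaves L ≟ leaves R)
    where
    a c s : ℕ
    a = leaves L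
    c = leaves R
    s = symmetricNodes L + symmetricNodes R

    grafted : List A × List A → List (LTree A)
    grafted p = graft (labellings L (proj₁ p)) (labellings R (proj₂ p))

    length-grafted : ∀ {p} → IsSplitOf a xs p →
                     length (grafted p) * (2 ^ symmetricNodes L * 2 ^ symmetricNodes R) ≡ a ! * c !
    length-grafted {ys , zs} split = begin
      length (grafted (ys , zs)) * (2 ^ symmetricNodes L * 2 ^ symmetricNodes R)
        ≡⟨ cong (_* _) (length-graft (labellings L ys) (labellings R zs)) ⟩
      (length (labellings L ys) * length (labellings R zs)) * (2 ^ symmetricNodes L * 2 ^ symmetricNodes R)
        ≡⟨ [m*n]*[o*p]≡[m*o]*[n*p] (length (labellings L ys)) _ _ _ ⟩
      (length (labellings L ys) * 2 ^ symmetricNodes L) * (length (labellings R zs) * 2 ^ symmetricNodes R)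
        ≡⟨ cong₂ _*_ (labellings-count L (proj₁ split))
                     (labellings-count R (isSplit-length-right (ys , zs) len split)) ⟩
      a ! * c !
        ∎

    length-grafts : (d : Dec (a ≡ c)) →
                    length (concatMap grafted (rootSplits d xs)) * 2 ^ s ≡ length (rootSplits d xs) * (a ! * c !)
    length-grafts d = trans
      (cong (length (concatMap grafted (rootSplits d xs)) *_) (^-distribˡ-+-* 2 (symmetricNodes L) (symmetricNodes R)))
      (length-concatMap (All.map length-grafted (rootSplits-isSplit d xs)))

    count : (d : Dec (a ≡ c)) →
            length (concatMap grafted (rootSplits d xs)) * 2 ^ (if does d then suc s else s) ≡ (a + c) !
    count d@(no _) = begin
      length (concatMap grafted (splits a xs)) * 2 ^ s
        ≡⟨ length-grafts d ⟩
      length (splits a xs) * (a ! * c !)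
        ≡⟨ cong (_* (a ! * c !)) (trans (length-splits a xs) (cong (_C a) len)) ⟩
      ((a + c) C a) * (a ! * c !)
        ≡⟨ [a+c]Ca*[a!*c!]≡[a+c]! a c ⟩
      (a + c) !
        ∎
    count d@(yes a≡c) = begin
      length (concatMap grafted (headSplits a xs)) * (2 * 2 ^ s)
        ≡⟨ x*[2*y]≡x*y*2 (length (concatMap grafted (headSplits a xs))) (2 ^ s) ⟩
      length (concatMap grafted (headSplits a xs)) * 2 ^ s * 2
        ≡⟨ cong (_* 2) (length-grafts d) ⟩
      length (headSplits a xs) * (a ! * c !) * 2
        ≡⟨ x*y*2≡x*2*y (length (headSplits a xs)) (a ! * c !) ⟩
      length (headSplits a xs) * 2 * (a ! * c !)
        ≡⟨ cong (_* (a ! * c !)) (length-headSplits {xs = xs} (0<leaves L) a≡c len) ⟩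
      ((a + c) C a) * (a ! * c !)
        ≡⟨ [a+c]Ca*[a!*c!]≡[a+c]! a c ⟩
      (a + c) !
        ∎
      where
      x*[2*y]≡x*y*2 : ∀ x y → x * (2 * y) ≡ x * y * 2
      x*[2*y]≡x*y*2 = solve-∀
      x*y*2≡x*2*y : ∀ x y → x * y * 2 ≡ x * 2 * y
      x*y*2≡x*2*y = solve-∀

^-monoʳ-∣ : ∀ b {i j} → i ≤ j → b ^ i ∣ b ^ j
^-monoʳ-∣ b z≤n       = 1∣ _
^-monoʳ-∣ b (s≤s i≤j) = *-monoʳ-∣ b (^-monoʳ-∣ b i≤j)

m/b^β≤q : ∀ b .{{_ : NonZero b}} {q k m β} → q * b ^ k ≡ m → ¬ (b ^ suc β ∣ m) →
          (m / b ^ β) {{m^n≢0 b β}} ≤ q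
m/b^β≤q b {q} {k} {m} {β} q*b^k≡m b^[1+β]∤m =
  ≤-trans (/-monoʳ-≤ m (^-monoʳ-≤ b k≤β))
          (≤-reflexive (trans (cong (_/ b ^ k) (sym q*b^k≡m)) (m*n/n≡m q (b ^ k))))
  where
  instance
    _ = m^n≢0 b β
    _ = m^n≢0 b k
  k≤β : k ≤ β
  k≤β = ≮⇒≥ (λ β<k → b^[1+β]∤m (∣-trans (^-monoʳ-∣ b β<k) (divides q (sym q*b^k≡m))))

map-proj₁-toList : ∀ {A : Set} {P : A → Set} {xs} (ps : All P xs) → map proj₁ (All.toList ps) ≡ xs
map-proj₁-toList []       = refl
map-proj₁-toList (p ∷ ps) = cong (_ ∷_) (map-proj₁-toList ps)

proposition18 : (n : ℕ) → 1 ≤ n → (β : ℕ) → 2 ^ β ∣ n ! → ¬ (2 ^ suc β ∣ n !) →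
    (T : Tree) → leaves T ≡ n →
    Σ (List (Summation n)) λ ss →
      All (λ s → shape (proj₁ s) ≅ T) ss ×
      AllPairs (λ s t → ¬ (s ≈c t)) ss ×
      _/_ (n !) (2 ^ β) {{m^n≢0 2 β}} ≤ length ss
proposition18 n _ β _ 2^[1+β]∤n! T leaves≡n =
  summations ,
  Allₚ.map⁻ (subst (All _) (sym forget) (All.map (λ (e , _) → subst (_≅ T) (sym e) ε) sound)) ,
  AllPairsₚ.map⁻ (subst (AllPairs _) (sym forget)
    (AllPairs.map (λ s≉t → s≉t ∘ Star-LSwap⇒≋) (labellings-inequivalent T (allFin⁺ n) len))) ,
  subst (_ ≤_) (sym length-summations) (m/b^β≤q 2 {k = symmetricNodes T} {β = β} count 2^[1+β]∤n!)
  where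
  xs : List (Fin n)
  xs = allFin n
  len : length xs ≡ leaves T
  len = trans (length-tabulate (λ i → i)) (sym leaves≡n)
  sound : All (λ t → shape t ≡ T × labels t ↭ xs) (labellings T xs)
  sound = labellings-sound T xs
  summations : List (Summation n)
  summations = All.toList (All.map proj₂ sound)
  forget : map proj₁ summations ≡ labellings T xs
  forget = map-proj₁-toList (All.map proj₂ sound)
  length-summations : length summations ≡ length (labellings T xs)
  length-summations = trans (sym (length-map proj₁ summations)) (cong length forget)
  count : length (labellings T xs) * 2 ^ symmetricNodes T ≡ n !
  count = subst (λ m → length (labellings T xs) * 2 ^ symmetricNodes T ≡ m !) leaves≡n (labellings-count T len)
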